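{- Let $\ell\ge 2$ be an integer and let $(V^{\sf small},V^{\sf large})$ be an $\alpha$-valuation of the complete bipartite graph $K_{a,b}$, with $|V^{\sf small}|=a$ and $|V^{\sf large}|=b$, such that every element of $V^{\sf small}$ is a multiple of $\ell$ and $V^{\sf large}$ is a union of runs $R_i=\{i\ell-\ell+1,i\ell-\ell+2,\dots,i\ell\}$. Let $W^{\sf small}=\{y/\ell: y\in V^{\sf small}\}$, and let $W^{\sf large}$ be the set obtained by replacing each run $R_i=\{i\ell-\ell+1,\dots,i\ell\}\subseteq V^{\sf large}$ by the single element $i$. Then $(W^{\sf small},W^{\sf large})$ is an $\alpha$-valuation of $K_{a,b/\ell}$.
   Context: An $\alpha$-valuation of $K_{a,b}$ is a one-to-one labelling of its vertices by elements of $\{0,1,\dots,ab\}$ such that the absolute differences of endpoint labels over all edges are exactly $\{1,\dots,ab\}$, and there is a value $x$ such that every edge joins a vertex with label $\le x$ to a vertex with label $>x$. Vertices are identified with their labels; $V^{\sf small}$ is the set of labels $\le x$ and $V^{\sf large}$ the set of labels $>x$; equivalently, every element of $V^{\sf large}$ exceeds every element of $V^{\sf small}$ and the differences $u-z$ ($u\in V^{\sf large}$, $z\in V^{\sf small}$) are exactly $1,\dots,ab$, each once. -}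

module Defs where

open import Data.Nat using (ℕ; _+_; _*_; _∸_; _≤_; _<_; suc)
open import Data.List using (List; length; map; upTo; cartesianProductWith)
open import Data.List.Relation.Unary.All using (All)
open import Data.List.Relation.Unary.Unique.Propositional using (Unique)
open import Data.List.Membership.Propositional using (_∈_)
open import Data.List.Relation.Binary.Permutation.Propositional using (_↭_)
open import Relation.Binary.PropositionalEquality using (_≡_)

-- Vertex-label sets are represented as duplicate-free lists of naturals.
-- The list of all differences u - z with u ∈ L, z ∈ S (one per edge).
differences : List ℕ → List ℕ → List ℕ
differences S L = cartesianProductWith (λ u z → u ∸ z) L S

oneTo : ℕ → List ℕ
oneTo n = map suc (upTo n)

record AlphaValuation (a b : ℕ) (S L : List ℕ) : Set where
  field
    uniqueSmall : Unique S
    uniqueLarge : Unique L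
    sizeSmall   : length S ≡ a
    sizeLarge   : length L ≡ b
    boundSmall  : All (_≤ a * b) S
    boundLarge  : All (_≤ a * b) L
    separated   : ∀ {z u} → z ∈ S → u ∈ L → z < u
    diffsExact  : differences S L ↭ oneTo (a * b)

InRun : ℕ → ℕ → ℕ → Set
InRun ℓ i v = (i * ℓ ∸ ℓ < v) Data.Product.× (v ≤ i * ℓ)
  where import Data.Product

{-# OPTIONS --safe #-}
-- Multiplication by ℓ undoes the compression: w ↦ wℓ maps W^small onto V^small and i ↦ iℓ maps
-- W^large onto the tops of the runs in V^large, multiplying every difference by ℓ.  So distinct
-- edges of the compressed graph have distinct differences, and d is a compressed difference iff
-- dℓ is a difference: if dℓ = u − z with ℓ ∣ z then ℓ ∣ u, so u is the top of a run.  The label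
-- ab is the largest difference, hence lies in V^large and is the top of its run; so ℓ ∣ ab, the
-- compressed differences are 1, …, ab/ℓ, and counting edges gives |W^large| = b/ℓ.

module Submission where

open import Defs
open import Data.Nat
  using (ℕ; zero; suc; _+_; _*_; _∸_; _≤_; _<_; _/_; _%_; NonZero; z≤n; s≤s; >-nonZero⁻¹; ≢-nonZero)
open import Data.Nat.Properties
open import Data.Nat.DivMod using (m≡m%n+[m/n]*n; m%n<n; m/n*n≡m; m*n/n≡m; m<n⇒m/n≡0)
open import Data.Nat.Divisibility using (_∣_; divides; _∣0)
open import Data.List using (List; []; _∷_; map; _++_; length; upTo; cartesianProductWith; cartesianProduct)
open import Data.List.Properties using (map-∘; map-++; length-map; length-++; length-upTo)
open import Data.List.Relation.Unary.All as All using (All; []; _∷_)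
import Data.List.Relation.Unary.All.Properties as All
open import Data.List.Relation.Unary.AllPairs using ([]; _∷_)
open import Data.List.Relation.Unary.Any using (here; there)
open import Data.List.Relation.Unary.Unique.Propositional using (Unique)
open import Data.List.Relation.Unary.Unique.Propositional.Properties using (cartesianProduct⁺; upTo⁺)
import Data.List.Relation.Unary.Unique.Propositional.Properties as Unique
open import Data.List.Membership.Propositional using (_∈_; _∉_)
open import Data.List.Membership.Propositional.Properties
open import Data.List.Membership.Propositional.Properties.WithK using (unique∧set⇒bag)
open import Data.List.Relation.Binary.BagAndSetEquality using (∼bag⇒↭)
open import Data.List.Relation.Binary.Permutation.Propositional using (_↭_; ↭-sym; ↭⇒↭ₛ)
open import Data.List.Relation.Binary.Permutation.Propositional.Properties using (∈-resp-↭; ↭-length)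
open import Data.List.Relation.Binary.Permutation.Setoid.Properties using (Unique-resp-↭)
open import Data.Product as Product using (_×_; _,_; proj₂; uncurry; ∃₂)
open import Data.Product.Properties using (,-injectiveˡ; ,-injectiveʳ)
open import Data.Empty using (⊥-elim)
open import Function.Bundles using (_⇔_; mk⇔; Equivalence)
open import Relation.Nullary using (yes; no)
open import Relation.Binary.PropositionalEquality
  using (_≡_; refl; sym; trans; cong; cong₂; subst; setoid; module ≡-Reasoning)

module _ {A B : Set} where

  InjectiveOn : (A → B) → List A → Set
  InjectiveOn f xs = ∀ {x y} → x ∈ xs → y ∈ xs → f x ≡ f y → x ≡ y

  unique-map⁺ : ∀ {f xs} → InjectiveOn f xs → Unique xs → Unique (map f xs)
  unique-map⁺ f-inj [] = []
  unique-map⁺ f-inj (x∉xs ∷ xs!) =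
    All.map⁺ (All.tabulate λ y∈xs fx≡fy → All.lookup x∉xs y∈xs (f-inj (here refl) (there y∈xs) fx≡fy))
    ∷ unique-map⁺ (λ x∈ y∈ → f-inj (there x∈) (there y∈)) xs!

  unique-map⇒injectiveOn : ∀ {f xs} → Unique (map f xs) → InjectiveOn f xs
  unique-map⇒injectiveOn _ (here refl) (here refl) _ = refl
  unique-map⇒injectiveOn {f} (fx∉ ∷ _) (here refl) (there y∈xs) fx≡fy =
    ⊥-elim (All.lookup fx∉ (∈-map⁺ f y∈xs) fx≡fy)
  unique-map⇒injectiveOn {f} (fy∉ ∷ _) (there x∈xs) (here refl) fx≡fy =
    ⊥-elim (All.lookup fy∉ (∈-map⁺ f x∈xs) (sym fx≡fy))
  unique-map⇒injectiveOn (_ ∷ fxs!) (there x∈xs) (there y∈xs) fx≡fy =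
    unique-map⇒injectiveOn fxs! x∈xs y∈xs fx≡fy

module _ {A B C : Set} (f : A → B → C) where

  InjectiveOn₂ : List A → List B → Set
  InjectiveOn₂ xs ys = ∀ {x x′ y y′} → x ∈ xs → x′ ∈ xs → y ∈ ys → y′ ∈ ys →
    f x y ≡ f x′ y′ → x ≡ x′ × y ≡ y′

  cartesianProductWith≡map : ∀ xs ys →
    cartesianProductWith f xs ys ≡ map (uncurry f) (cartesianProduct xs ys)
  cartesianProductWith≡map []       ys = refl
  cartesianProductWith≡map (x ∷ xs) ys = begin
    map (f x) ys ++ cartesianProductWith f xs ys
      ≡⟨ cong₂ _++_ (map-∘ ys) (cartesianProductWith≡map xs ys) ⟩
    map (uncurry f) (map (x ,_) ys) ++ map (uncurry f) (cartesianProduct xs ys)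
      ≡⟨ map-++ (uncurry f) (map (x ,_) ys) (cartesianProduct xs ys) ⟨
    map (uncurry f) (cartesianProduct (x ∷ xs) ys) ∎
    where open ≡-Reasoning

  length-cartesianProductWith : ∀ xs ys →
    length (cartesianProductWith f xs ys) ≡ length xs * length ys
  length-cartesianProductWith []       ys = refl
  length-cartesianProductWith (x ∷ xs) ys = trans (length-++ (map (f x) ys))
    (cong₂ _+_ (length-map (f x) ys) (length-cartesianProductWith xs ys))

  unique-cartesianProductWith : ∀ {xs ys} → Unique xs → Unique ys → InjectiveOn₂ xs ys →
    Unique (cartesianProductWith f xs ys)
  unique-cartesianProductWith {xs} {ys} xs! ys! f-inj =
    subst Unique (sym (cartesianProductWith≡map xs ys)) (unique-map⁺ pair-inj (cartesianProduct⁺ xs! ys!))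
    where
    pair-inj : InjectiveOn (uncurry f) (cartesianProduct xs ys)
    pair-inj {x , y} {x′ , y′} p p′ e with ∈-cartesianProduct⁻ xs ys p | ∈-cartesianProduct⁻ xs ys p′
    ... | x∈ , y∈ | x′∈ , y′∈ = uncurry (cong₂ _,_) (f-inj x∈ x′∈ y∈ y′∈ e)

  unique-cartesianProductWith⇒injectiveOn₂ : ∀ {xs ys} → Unique (cartesianProductWith f xs ys) →
    InjectiveOn₂ xs ys
  unique-cartesianProductWith⇒injectiveOn₂ {xs} {ys} u x∈ x′∈ y∈ y′∈ e =
    ,-injectiveˡ pairs-equal , ,-injectiveʳ pairs-equal
    where
    pairs-equal = unique-map⇒injectiveOn (subst Unique (cartesianProductWith≡map xs ys) u)
      (∈-cartesianProduct⁺ x∈ y∈) (∈-cartesianProduct⁺ x′∈ y′∈) e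

∀∉⇒≡[] : ∀ {A : Set} {xs : List A} → (∀ {x} → x ∉ xs) → xs ≡ []
∀∉⇒≡[] {xs = []}    _   = refl
∀∉⇒≡[] {xs = _ ∷ _} ∉xs = ⊥-elim (∉xs (here refl))

length-unique-constant : ∀ {A : Set} {c : A} {xs} → Unique xs → All (_≡ c) xs → length xs ≤ 1
length-unique-constant {xs = []}        _               _                 = z≤n
length-unique-constant {xs = _ ∷ []}    _               _                 = ≤-refl
length-unique-constant {xs = _ ∷ _ ∷ _} ((x≢y ∷ _) ∷ _) (x≡c ∷ y≡c ∷ _) = ⊥-elim (x≢y (trans x≡c (sym y≡c)))

∈-oneTo⁺ : ∀ {n x} → 1 ≤ x → x ≤ n → x ∈ oneTo n
∈-oneTo⁺ {x = suc x} _ x<n = ∈-map⁺ suc (∈-upTo⁺ x<n)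

∈-oneTo⁻ : ∀ {n x} → x ∈ oneTo n → 1 ≤ x × x ≤ n
∈-oneTo⁻ x∈ with ∈-map⁻ suc x∈
... | _ , y∈ , refl = s≤s z≤n , ∈-upTo⁻ y∈

oneTo-unique : ∀ n → Unique (oneTo n)
oneTo-unique n = Unique.map⁺ suc-injective (upTo⁺ n)

length-oneTo : ∀ n → length (oneTo n) ≡ n
length-oneTo n = trans (length-map suc (upTo n)) (length-upTo n)

inRun-top : ∀ ℓ .{{_ : NonZero ℓ}} {i} → 1 ≤ i → InRun ℓ i (i * ℓ)
inRun-top ℓ {suc j} _ =
  subst (_< suc j * ℓ) (sym (m+n∸m≡n ℓ (j * ℓ))) (m<n+m (j * ℓ) (>-nonZero⁻¹ ℓ)) , ≤-refl

inRun-suc : ∀ ℓ .{{_ : NonZero ℓ}} v → InRun ℓ (suc (v / ℓ)) (suc v)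
inRun-suc ℓ v =
  subst (_< suc v) (sym (m+n∸m≡n ℓ (q * ℓ))) (s≤s (subst (q * ℓ ≤_) (sym v≡) (m≤n+m (q * ℓ) (v % ℓ)))) ,
  subst (λ x → suc x ≤ ℓ + q * ℓ) (sym v≡) (+-monoˡ-≤ (q * ℓ) (m%n<n v ℓ))
  where
  q = v / ℓ
  v≡ = m≡m%n+[m/n]*n v ℓ

module Compression
  (ℓ a b : ℕ) (2≤ℓ : 2 ≤ ℓ) .{{_ : NonZero ℓ}}
  (S L : List ℕ) (αv : AlphaValuation a b S L)
  (ℓ∣S : ∀ {y} → y ∈ S → ℓ ∣ y)
  (runs-closed : ∀ {u} i → u ∈ L → InRun ℓ i u → ∀ v → InRun ℓ i v → v ∈ L)
  (WL : List ℕ) (WL! : Unique WL)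
  (WL⇔ : ∀ i → (i ∈ WL) ⇔ ((1 ≤ i) × (∀ v → InRun ℓ i v → v ∈ L)))
  where

  open AlphaValuation αv

  N K : ℕ
  N = a * b
  K = N / ℓ

  WS : List ℕ
  WS = map (_/ ℓ) S

  ℓ≥1 : 1 ≤ ℓ
  ℓ≥1 = >-nonZero⁻¹ ℓ

  differences-unique : Unique (differences S L)
  differences-unique = Unique-resp-↭ (setoid ℕ) (↭⇒↭ₛ (↭-sym diffsExact)) (oneTo-unique N)

  differences-injective : InjectiveOn₂ _∸_ L S
  differences-injective = unique-cartesianProductWith⇒injectiveOn₂ _∸_ differences-unique

  ∈-differences : ∀ {d} → 1 ≤ d → d ≤ N → ∃₂ λ u z → u ∈ L × z ∈ S × d ≡ u ∸ z
  ∈-differences 1≤d d≤N =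
    ∈-cartesianProductWith⁻ _∸_ L S (∈-resp-↭ (↭-sym diffsExact) (∈-oneTo⁺ 1≤d d≤N))

  N∈L : 1 ≤ N → N ∈ L
  N∈L 1≤N with ∈-differences 1≤N ≤-refl
  ... | u , z , u∈L , _ , N≡u∸z = subst (_∈ L) u≡N u∈L
    where
    u≡N : u ≡ N
    u≡N = ≤-antisym (All.lookup boundLarge u∈L) (≤-trans (≤-reflexive N≡u∸z) (m∸n≤m u z))

  -- The top of the run containing an upper bound of L lies in L, so it cannot exceed it.
  upper-bound-multiple : ∀ {v} → v ∈ L → (∀ {u} → u ∈ L → u ≤ v) → ℓ ∣ v
  upper-bound-multiple {zero}  _   _  = ℓ ∣0
  upper-bound-multiple {suc v} v∈L ≤v = divides i (≤-antisym (proj₂ (inRun-suc ℓ v)) (≤v top∈L))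
    where
    i = suc (v / ℓ)
    top∈L : i * ℓ ∈ L
    top∈L = runs-closed i v∈L (inRun-suc ℓ v) (i * ℓ) (inRun-top ℓ {i} (s≤s z≤n))

  N≡K*ℓ : N ≡ K * ℓ
  N≡K*ℓ with N ≟ 0
  ... | yes N≡0 = sym (m/n*n≡m (subst (ℓ ∣_) (sym N≡0) (ℓ ∣0)))
  ... | no  N≢0 = sym (m/n*n≡m (upper-bound-multiple (N∈L (n≢0⇒n>0 N≢0)) (All.lookup boundLarge)))

  WS→S : ∀ {w} → w ∈ WS → w * ℓ ∈ S
  WS→S w∈WS with ∈-map⁻ (_/ ℓ) w∈WS
  ... | z , z∈S , refl = subst (_∈ S) (sym (m/n*n≡m (ℓ∣S z∈S))) z∈S

  WL→L : ∀ {i} → i ∈ WL → 1 ≤ i × i * ℓ ∈ L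
  WL→L {i} i∈WL with Equivalence.to (WL⇔ i) i∈WL
  ... | 1≤i , Rᵢ⊆L = 1≤i , Rᵢ⊆L (i * ℓ) (inRun-top ℓ 1≤i)

  L→WL : ∀ {i} → 1 ≤ i → i * ℓ ∈ L → i ∈ WL
  L→WL {i} 1≤i iℓ∈L = Equivalence.from (WL⇔ i) (1≤i , runs-closed i iℓ∈L (inRun-top ℓ 1≤i))

  WS-unique : Unique WS
  WS-unique = unique-map⁺ /ℓ-injective uniqueSmall
    where
    /ℓ-injective : InjectiveOn (_/ ℓ) S
    /ℓ-injective y∈S z∈S y/ℓ≡z/ℓ = begin
      _            ≡⟨ m/n*n≡m (ℓ∣S y∈S) ⟨
      _ / ℓ * ℓ    ≡⟨ cong (_* ℓ) y/ℓ≡z/ℓ ⟩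
      _ / ℓ * ℓ    ≡⟨ m/n*n≡m (ℓ∣S z∈S) ⟩
      _            ∎
      where open ≡-Reasoning

  length-WS : length WS ≡ a
  length-WS = trans (length-map (_/ ℓ) S) sizeSmall

  WS<WL : ∀ {w i} → w ∈ WS → i ∈ WL → w < i
  WS<WL {w} {i} w∈WS i∈WL = *-cancelʳ-< ℓ w i (separated (WS→S w∈WS) (proj₂ (WL→L i∈WL)))

  ≤K : ∀ {x} → x * ℓ ≤ N → x ≤ K
  ≤K {x} xℓ≤N = *-cancelʳ-≤ x K ℓ (subst (x * ℓ ≤_) N≡K*ℓ xℓ≤N)

  WS≤K : ∀ {w} → w ∈ WS → w ≤ K
  WS≤K w∈WS = ≤K (All.lookup boundSmall (WS→S w∈WS))

  WL≤K : ∀ {i} → i ∈ WL → i ≤ K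
  WL≤K i∈WL = ≤K (All.lookup boundLarge (proj₂ (WL→L i∈WL)))

  -- Scaling by ℓ embeds WL × WS into L × S and multiplies each difference by ℓ.
  compressed-differences-injective : InjectiveOn₂ _∸_ WL WS
  compressed-differences-injective {i} {i′} {w} {w′} i∈WL i′∈WL w∈WS w′∈WS i∸w≡i′∸w′ =
    Product.map (*-cancelʳ-≡ i i′ ℓ) (*-cancelʳ-≡ w w′ ℓ)
      (differences-injective (proj₂ (WL→L i∈WL)) (proj₂ (WL→L i′∈WL)) (WS→S w∈WS) (WS→S w′∈WS) scaled)
    where
    open ≡-Reasoning
    scaled : i * ℓ ∸ w * ℓ ≡ i′ * ℓ ∸ w′ * ℓ
    scaled = begin
      i * ℓ ∸ w * ℓ    ≡⟨ *-distribʳ-∸ ℓ i w ⟨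
      (i ∸ w) * ℓ      ≡⟨ cong (_* ℓ) i∸w≡i′∸w′ ⟩
      (i′ ∸ w′) * ℓ    ≡⟨ *-distribʳ-∸ ℓ i′ w′ ⟩
      i′ * ℓ ∸ w′ * ℓ  ∎

  compressed-differences⁻ : ∀ {d} → d ∈ differences WS WL → d ∈ oneTo K
  compressed-differences⁻ d∈ with ∈-cartesianProductWith⁻ _∸_ WL WS d∈
  ... | i , w , i∈WL , w∈WS , refl =
    ∈-oneTo⁺ (m<n⇒0<n∸m (WS<WL w∈WS i∈WL)) (≤-trans (m∸n≤m i w) (WL≤K i∈WL))

  -- d ℓ = u − z with z = w ℓ forces u = (d + w) ℓ, the top of a run in L.
  compressed-differences⁺ : ∀ {d} → d ∈ oneTo K → d ∈ differences WS WL
  compressed-differences⁺ {d} d∈ with ∈-oneTo⁻ d∈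
  ... | 1≤d , d≤K with ∈-differences (*-mono-≤ 1≤d ℓ≥1) (subst (d * ℓ ≤_) (sym N≡K*ℓ) (*-monoˡ-≤ ℓ d≤K))
  ... | u , z , u∈L , z∈S , dℓ≡u∸z =
    subst (_∈ differences WS WL) (m+n∸n≡m d w)
      (∈-cartesianProductWith⁺ _∸_ (L→WL (≤-trans 1≤d (m≤m+n d w)) (subst (_∈ L) u≡ u∈L)) (∈-map⁺ (_/ ℓ) z∈S))
    where
    open ≡-Reasoning
    w = z / ℓ
    u≡ : u ≡ (d + w) * ℓ
    u≡ = begin
      u                ≡⟨ m∸n+n≡m (<⇒≤ (separated z∈S u∈L)) ⟨
      u ∸ z + z        ≡⟨ cong₂ _+_ dℓ≡u∸z (m/n*n≡m (ℓ∣S z∈S)) ⟨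
      d * ℓ + w * ℓ    ≡⟨ *-distribʳ-+ ℓ d w ⟨
      (d + w) * ℓ      ∎

  compressed-diffsExact : differences WS WL ↭ oneTo K
  compressed-diffsExact = ∼bag⇒↭ (unique∧set⇒bag
    (unique-cartesianProductWith _∸_ WL! WS-unique compressed-differences-injective)
    (oneTo-unique K)
    (mk⇔ compressed-differences⁻ compressed-differences⁺))

  |WL|*a≡K : length WL * a ≡ K
  |WL|*a≡K = begin
    length WL * a               ≡⟨ cong (length WL *_) length-WS ⟨
    length WL * length WS       ≡⟨ length-cartesianProductWith _∸_ WL WS ⟨
    length (differences WS WL)  ≡⟨ ↭-length compressed-diffsExact ⟩
    length (oneTo K)            ≡⟨ length-oneTo K ⟩
    K                           ∎
    where open ≡-Reasoning

  -- For a = 0, L ⊆ {0} may be nonempty, so b is not determined by counting edges.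
  b/ℓ≡|WL| : b / ℓ ≡ length WL
  b/ℓ≡|WL| with a ≟ 0
  ... | yes a≡0 = trans (m<n⇒m/n≡0 (≤-trans (s≤s b≤1) 2≤ℓ)) (sym (cong length WL≡[]))
    where
    L≤0 : All (_≤ 0) L
    L≤0 = subst (λ n → All (_≤ n) L) (cong (_* b) a≡0) boundLarge
    b≤1 : b ≤ 1
    b≤1 = subst (_≤ 1) sizeLarge (length-unique-constant uniqueLarge (All.map n≤0⇒n≡0 L≤0))
    WL≡[] : WL ≡ []
    WL≡[] = ∀∉⇒≡[] λ i∈WL → let 1≤i , iℓ∈L = WL→L i∈WL in
      <⇒≱ (*-mono-≤ 1≤i ℓ≥1) (All.lookup L≤0 iℓ∈L)
  ... | no  a≢0 = trans (cong (_/ ℓ) b≡|WL|*ℓ) (m*n/n≡m (length WL) ℓ)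
    where
    open ≡-Reasoning
    b≡|WL|*ℓ : b ≡ length WL * ℓ
    b≡|WL|*ℓ = *-cancelˡ-≡ b (length WL * ℓ) a {{≢-nonZero a≢0}} (begin
      a * b                    ≡⟨ N≡K*ℓ ⟩
      K * ℓ                    ≡⟨ cong (_* ℓ) |WL|*a≡K ⟨
      length WL * a * ℓ        ≡⟨ cong (_* ℓ) (*-comm (length WL) a) ⟩
      a * length WL * ℓ        ≡⟨ *-assoc a (length WL) ℓ ⟩
      a * (length WL * ℓ)      ∎)

  K≡a*[b/ℓ] : K ≡ a * (b / ℓ)
  K≡a*[b/ℓ] = begin
    K                ≡⟨ |WL|*a≡K ⟨
    length WL * a    ≡⟨ *-comm (length WL) a ⟩
    a * length WL    ≡⟨ cong (a *_) b/ℓ≡|WL| ⟨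
    a * (b / ℓ)      ∎
    where open ≡-Reasoning

theorem2p12 : (ℓ a b : ℕ) → 2 ≤ ℓ → .{{_ : NonZero ℓ}} →
    (S L : List ℕ) → AlphaValuation a b S L →
    (∀ {y} → y ∈ S → ℓ ∣ y) →
    (∀ {u} i → u ∈ L → InRun ℓ i u → ∀ v → InRun ℓ i v → v ∈ L) →
    (WL : List ℕ) → Unique WL →
    (∀ i → (i ∈ WL) ⇔ ((1 ≤ i) × (∀ v → InRun ℓ i v → v ∈ L))) →
    AlphaValuation a (b / ℓ) (map (_/ ℓ) S) WL
theorem2p12 ℓ a b 2≤ℓ S L αv ℓ∣S runs-closed WL WL! WL⇔ = record
  { uniqueSmall = WS-unique
  ; uniqueLarge = WL!
  ; sizeSmall   = length-WS
  ; sizeLarge   = sym b/ℓ≡|WL|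
  ; boundSmall  = All.tabulate λ w∈WS → ≤-trans (WS≤K w∈WS) (≤-reflexive K≡a*[b/ℓ])
  ; boundLarge  = All.tabulate λ i∈WL → ≤-trans (WL≤K i∈WL) (≤-reflexive K≡a*[b/ℓ])
  ; separated   = WS<WL
  ; diffsExact  = subst (λ n → differences WS WL ↭ oneTo n) K≡a*[b/ℓ] compressed-diffsExact
  }
  where open Compression ℓ a b 2≤ℓ S L αv ℓ∣S runs-closed WL WL! WL⇔
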